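{- Let $m\ge1$ and $S\subseteq[m]$. Define $(Y_1,\dots,Y_m)$ by: if $i\notin S$ then $Y_i=2i$; if $i\in S$ then $Y_i=i_0+i$, where $i_0$ is the largest $j<i$ with $j\notin S$ (and $i_0=0$ if no such $j$ exists). Then every $T\in YT((m,m),S)$ with $y$-sequence $(y_1,\dots,y_m)$ satisfies $Y_i\le y_i\le m+i$ for all $1\le i\le m$.
   Context: $YT((m,m),S)$ is the set of fillings of a $2\times m$ rectangle with $1,\dots,2m$, each used once, with one row $y_1<y_2<\dots<y_m$ and the other row $x_1<x_2<\dots<x_m$, such that $x_i<y_i$ for every column $i\notin S$ (no condition in columns $i\in S$). The $y$-sequence of $T$ is $(y_1,\dots,y_m)$. -}

module Defs where

open import Data.Nat using (ℕ; zero; suc; _+_; _*_; _∸_; _≤_; _<_; _<?_)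
open import Data.Bool using (Bool; true; false; not; if_then_else_)
open import Data.Fin using (Fin; toℕ; fromℕ<)
open import Data.Fin.Subset using (Subset; _∈_; _∉_)
open import Data.Fin.Subset.Properties using (_∈?_)
open import Data.Product using (∃; _×_)
open import Data.Sum using (_⊎_)
open import Relation.Nullary using (does)
open import Relation.Binary.PropositionalEquality using (_≡_; _≢_)

-- Columns are indexed by i : Fin m; the paper's 1-based column number is col i = toℕ i + 1.
col : ∀ {m} → Fin m → ℕ
col i = suc (toℕ i)

-- A filling of a 2×m rectangle: row x and row y, entries in ℕ.
record Filling (m : ℕ) : Set where
  field
    x : Fin m → ℕ
    y : Fin m → ℕ

record IsYT {m : ℕ} (S : Subset m) (T : Filling m) : Set where
  open Filling T
  field
    x-range   : ∀ i → 1 ≤ x i × x i ≤ 2 * m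
    y-range   : ∀ i → 1 ≤ y i × y i ≤ 2 * m
    -- each of 1,…,2m is used (at least once) ...
    surj      : ∀ v → 1 ≤ v → v ≤ 2 * m → (∃ λ i → x i ≡ v) ⊎ (∃ λ i → y i ≡ v)
    -- ... and at most once (within rows by strictness; across rows:)
    disjoint  : ∀ i j → x i ≢ y j
    x-incr    : ∀ i j → toℕ i < toℕ j → x i < x j
    y-incr    : ∀ i j → toℕ i < toℕ j → y i < y j
    column    : ∀ i → i ∉ S → x i < y i

-- notInS S j : is the 1-based column j (1 ≤ j ≤ m) outside S ?  (false for j = 0 or j > m)
notInS : ∀ {m} → Subset m → ℕ → Bool
notInS S zero = false
notInS {m} S (suc j) with j <? m
... | Relation.Nullary.yes p = not (does (fromℕ< p ∈? S))
... | Relation.Nullary.no _  = false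

lastNotIn : ∀ {m} → Subset m → ℕ → ℕ
lastNotIn S zero    = 0
lastNotIn S (suc k) = if notInS S (suc k) then suc k else lastNotIn S k

-- i₀ for column i (1-based c): largest j < c with j ∉ S, or 0.
i₀ : ∀ {m} → Subset m → Fin m → ℕ
i₀ S i = lastNotIn S (toℕ i)

Yseq : ∀ {m} → Subset m → Fin m → ℕ
Yseq S i = if does (i ∈? S) then i₀ S i + col i else 2 * col i

-- For a column i ∉ S the entries x_j, y_j of the columns j ≤ i are 2i distinct
-- positive numbers, all at most y_i because x_j ≤ x_i < y_i; hence y_i ≥ 2i.
-- A strictly increasing row satisfies y_j + (i − j) ≤ y_i for j ≤ i. Taking j = i₀ ∉ S
-- gives y_i ≥ 2i₀ + (i − i₀) = Y_i (and y_i ≥ y_1 + i − 1 ≥ i when i₀ = 0), while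
-- the same inequality for i ≤ m, together with y_m ≤ 2m, gives y_i ≤ m + i.

module Submission where

open import Defs
open import Data.Nat using (ℕ; _≤_; _+_)
open import Data.Fin.Subset using (Subset)
open import Data.Product using (_×_)

open import Level using (Level)
open import Function using (_∘_; Injective)
open import Data.Nat as ℕ using (_<?_; zero; suc; _*_; z≤n; s≤s; s≤s⁻¹; z<s; s<s)
open import Data.Nat.Properties
  using (≤-refl; ≤-reflexive; ≤-trans; <⇒≤; m<n⇒m<1+n; <⇒≢; >⇒≢; m≤n⇒m<n∨m≡n;
         +-suc; +-comm; +-identityʳ; +-monoˡ-≤; +-cancelʳ-≤; module ≤-Reasoning)
open import Data.Nat.Tactic.RingSolver using (solve-∀)
import Data.Fin as Fin
open import Data.Fin using (Fin; zero; suc; toℕ; fromℕ; fromℕ<; inject≤; splitAt)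
open import Data.Fin.Properties
  using (toℕ-injective; toℕ-fromℕ; toℕ-fromℕ<; toℕ-inject≤; toℕ<n; ≤fromℕ;
         inject≤-injective; join-splitAt; injective⇒≤)
import Data.Fin.Properties as Finₚ
open import Data.Fin.Subset using (_∉_)
open import Data.Fin.Subset.Properties using (_∈?_)
open import Data.Product using (∃; _,_; proj₁; proj₂)
open import Data.Sum using (_⊎_; inj₁; inj₂; [_,_]′)
open import Relation.Nullary using (yes; no; contradiction)
open import Relation.Binary using (_Preserves_⟶_; tri<; tri≈; tri>)
open import Relation.Binary.PropositionalEquality using (_≡_; _≢_; refl; sym; trans; cong; subst; subst₂; module ≡-Reasoning)

private
  variable
    a b c : Level
    A : Set a
    B : Set b
    C : Set c

[,]-injective : {f : A → C} {g : B → C} → Injective _≡_ _≡_ f → Injective _≡_ _≡_ g →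
                (∀ u v → f u ≢ g v) → Injective _≡_ _≡_ [ f , g ]′
[,]-injective f-inj g-inj disjoint {inj₁ u} {inj₁ u′} eq = cong inj₁ (f-inj eq)
[,]-injective f-inj g-inj disjoint {inj₁ u} {inj₂ v}  eq = contradiction eq (disjoint u v)
[,]-injective f-inj g-inj disjoint {inj₂ v} {inj₁ u}  eq = contradiction (sym eq) (disjoint u v)
[,]-injective f-inj g-inj disjoint {inj₂ v} {inj₂ v′} eq = cong inj₂ (g-inj eq)

splitAt-injective : ∀ m {n} → Injective _≡_ _≡_ (splitAt m {n})
splitAt-injective m {n} {i} {j} eq =
  trans (sym (join-splitAt m n i)) (trans (cong (Fin.join m n) eq) (join-splitAt m n j))

injective-into-[1,b]⇒≤ : ∀ {n b} (f : Fin n → ℕ) → Injective _≡_ _≡_ f →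
                         (∀ k → 1 ≤ f k × f k ≤ b) → n ≤ b
injective-into-[1,b]⇒≤ {n} {b} f f-inj range = injective⇒≤ g-inj
  where
  predFin : ∀ {v} → 1 ≤ v × v ≤ b → Fin b
  predFin {suc u} (_ , v≤b) = fromℕ< v≤b

  suc-toℕ-predFin : ∀ {v} (v∈[1,b] : 1 ≤ v × v ≤ b) → suc (toℕ (predFin v∈[1,b])) ≡ v
  suc-toℕ-predFin {suc u} (_ , v≤b) = cong suc (toℕ-fromℕ< v≤b)

  g : Fin n → Fin b
  g = predFin ∘ range

  g-inj : Injective _≡_ _≡_ g
  g-inj {k} {l} eq = f-inj (begin
    f k                  ≡⟨ suc-toℕ-predFin (range k) ⟨
    suc (toℕ (g k))      ≡⟨ cong (suc ∘ toℕ) eq ⟩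
    suc (toℕ (g l))      ≡⟨ suc-toℕ-predFin (range l) ⟩
    f l                  ∎)
    where open ≡-Reasoning

module _ {n} {f : Fin n → ℕ} (f-incr : f Preserves Fin._<_ ⟶ ℕ._<_) where

  strictlyIncreasing⇒injective : Injective _≡_ _≡_ f
  strictlyIncreasing⇒injective {i} {j} eq with Finₚ.<-cmp i j
  ... | tri< i<j _ _ = contradiction eq (<⇒≢ (f-incr i<j))
  ... | tri≈ _ i≡j _ = i≡j
  ... | tri> _ _ i>j = contradiction eq (>⇒≢ (f-incr i>j))

  strictlyIncreasing⇒monotone : f Preserves Fin._≤_ ⟶ ℕ._≤_
  strictlyIncreasing⇒monotone {i} {j} i≤j with m≤n⇒m<n∨m≡n i≤j
  ... | inj₁ i<j = <⇒≤ (f-incr i<j)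
  ... | inj₂ i≡j rewrite toℕ-injective i≡j = ≤-refl

-- The subtraction-free form of  f j − f i ≥ toℕ j − toℕ i.
strictlyIncreasing⇒gap : ∀ {n} {f : Fin n → ℕ} → f Preserves Fin._<_ ⟶ ℕ._<_ →
                         ∀ {i j} → i Fin.≤ j → f i + toℕ j ≤ f j + toℕ i
strictlyIncreasing⇒gap f-incr {zero} {zero} _ = ≤-refl
strictlyIncreasing⇒gap {f = f} f-incr {zero} {suc zero} _ =
  subst₂ _≤_ (+-comm 1 (f zero)) (sym (+-identityʳ _)) (f-incr z<s)
strictlyIncreasing⇒gap {f = f} f-incr {zero} {suc (suc j)} _ = begin
  f zero + suc (suc (toℕ j))    ≡⟨ +-suc (f zero) (suc (toℕ j)) ⟩
  suc (f zero) + suc (toℕ j)    ≤⟨ +-monoˡ-≤ (suc (toℕ j)) (f-incr z<s) ⟩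
  f (suc zero) + suc (toℕ j)    ≤⟨ strictlyIncreasing⇒gap (f-incr ∘ s<s) {zero} {suc j} z≤n ⟩
  f (suc (suc j)) + 0           ∎
  where open ≤-Reasoning
strictlyIncreasing⇒gap f-incr {suc i} {suc j} i≤j =
  subst₂ _≤_ (sym (+-suc _ _)) (sym (+-suc _ _))
    (s≤s (strictlyIncreasing⇒gap (f-incr ∘ s<s) {i} {j} (s≤s⁻¹ i≤j)))

ZeroOrColumnNotInBefore : ∀ {m} → Subset m → ℕ → ℕ → Set
ZeroOrColumnNotInBefore S k ℓ = ℓ ≡ 0 ⊎ ∃ λ j → ℓ ≡ col j × toℕ j ℕ.< k × j ∉ S

zeroOrColumnNotInBefore-suc : ∀ {m} {S : Subset m} {k ℓ} →
                              ZeroOrColumnNotInBefore S k ℓ → ZeroOrColumnNotInBefore S (suc k) ℓ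
zeroOrColumnNotInBefore-suc (inj₁ ℓ≡0) = inj₁ ℓ≡0
zeroOrColumnNotInBefore-suc (inj₂ (j , ℓ≡j , j<k , j∉S)) = inj₂ (j , ℓ≡j , m<n⇒m<1+n j<k , j∉S)

lastNotIn-zeroOrColumnNotInBefore : ∀ {m} (S : Subset m) k → ZeroOrColumnNotInBefore S k (lastNotIn S k)
lastNotIn-zeroOrColumnNotInBefore S zero = inj₁ refl
lastNotIn-zeroOrColumnNotInBefore {m} S (suc k) with k ℕ.<? m
... | no _ = zeroOrColumnNotInBefore-suc (lastNotIn-zeroOrColumnNotInBefore S k)
... | yes k<m with fromℕ< k<m ∈? S
...   | yes _ = zeroOrColumnNotInBefore-suc (lastNotIn-zeroOrColumnNotInBefore S k)
...   | no k∉S =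
  inj₂ (fromℕ< k<m , cong suc (sym (toℕ-fromℕ< k<m)) , ≤-reflexive (cong suc (toℕ-fromℕ< k<m)) , k∉S)

module _ {n} {S : Subset (suc n)} {T : Filling (suc n)} (isYT : IsYT S T) where
  open Filling T
  open IsYT isYT

  x-increasing : x Preserves Fin._<_ ⟶ ℕ._<_
  x-increasing {i} {j} = x-incr i j

  y-increasing : y Preserves Fin._<_ ⟶ ℕ._<_
  y-increasing {i} {j} = y-incr i j

  2*col≤y : ∀ i → i ∉ S → 2 * col i ≤ y i
  2*col≤y i i∉S = subst (_≤ y i) (cong (col i +_) (sym (+-identityʳ (col i))))
    (injective-into-[1,b]⇒≤ entries entries-injective (entry-range ∘ splitAt (col i)))
    where
    prefix : Fin (col i) → Fin (suc n)
    prefix j = inject≤ j (toℕ<n i)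

    prefix-injective : Injective _≡_ _≡_ prefix
    prefix-injective = inject≤-injective _ _ _ _

    prefix≤i : ∀ j → prefix j Fin.≤ i
    prefix≤i j = subst (ℕ._≤ toℕ i) (sym (toℕ-inject≤ j (toℕ<n i))) (s≤s⁻¹ (toℕ<n j))

    entry : Fin (col i) ⊎ Fin (col i) → ℕ
    entry = [ x ∘ prefix , y ∘ prefix ]′

    entries : Fin (col i + col i) → ℕ
    entries = entry ∘ splitAt (col i)

    entries-injective : Injective _≡_ _≡_ entries
    entries-injective = splitAt-injective (col i) ∘
      [,]-injective (prefix-injective ∘ strictlyIncreasing⇒injective x-increasing)
                    (prefix-injective ∘ strictlyIncreasing⇒injective y-increasing)
                    (λ j k → disjoint (prefix j) (prefix k))

    entry-range : ∀ s → 1 ≤ entry s × entry s ≤ y i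
    entry-range (inj₁ j) = proj₁ (x-range (prefix j)) ,
      ≤-trans (strictlyIncreasing⇒monotone x-increasing (prefix≤i j)) (<⇒≤ (column i i∉S))
    entry-range (inj₂ j) = proj₁ (y-range (prefix j)) ,
      strictlyIncreasing⇒monotone y-increasing (prefix≤i j)

  i₀+col≤y : ∀ i → i₀ S i + col i ≤ y i
  i₀+col≤y i with lastNotIn-zeroOrColumnNotInBefore S (toℕ i)
  ... | inj₁ i₀≡0 = subst (λ ℓ → ℓ + col i ≤ y i) (sym i₀≡0) (begin
    col i                ≤⟨ +-monoˡ-≤ (toℕ i) (proj₁ (y-range zero)) ⟩
    y zero + toℕ i       ≤⟨ strictlyIncreasing⇒gap y-increasing {zero} {i} z≤n ⟩
    y i + 0              ≡⟨ +-identityʳ (y i) ⟩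
    y i                  ∎)
    where open ≤-Reasoning
  ... | inj₂ (j , i₀≡col-j , j<i , j∉S) = subst (λ ℓ → ℓ + col i ≤ y i) (sym i₀≡col-j)
    (+-cancelʳ-≤ (toℕ j) _ _ (begin
      col j + col i + toℕ j    ≡⟨ rearrange (toℕ j) (toℕ i) ⟩
      2 * col j + toℕ i        ≤⟨ +-monoˡ-≤ (toℕ i) (2*col≤y j j∉S) ⟩
      y j + toℕ i              ≤⟨ strictlyIncreasing⇒gap y-increasing (<⇒≤ j<i) ⟩
      y i + toℕ j              ∎))
    where
    open ≤-Reasoning
    rearrange : ∀ a b → suc a + suc b + a ≡ 2 * suc a + b
    rearrange = solve-∀

  y≤m+col : ∀ i → y i ≤ suc n + col i
  y≤m+col i = +-cancelʳ-≤ n _ _ (begin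
    y i + n                  ≡⟨ cong (y i +_) (sym (toℕ-fromℕ n)) ⟩
    y i + toℕ (fromℕ n)      ≤⟨ strictlyIncreasing⇒gap y-increasing (≤fromℕ i) ⟩
    y (fromℕ n) + toℕ i      ≤⟨ +-monoˡ-≤ (toℕ i) (proj₂ (y-range (fromℕ n))) ⟩
    2 * suc n + toℕ i        ≡⟨ rearrange n (toℕ i) ⟩
    suc n + col i + n        ∎)
    where
    open ≤-Reasoning
    rearrange : ∀ a b → 2 * suc a + b ≡ suc a + suc b + a
    rearrange = solve-∀

lemma2p2 : (m : ℕ) → 1 ≤ m → (S : Subset m) → (T : Filling m) → IsYT S T →
    ∀ i → Yseq S i ≤ Filling.y T i × Filling.y T i ≤ m + col i
lemma2p2 (suc n) _ S T isYT i = lower , y≤m+col isYT i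
  where
  lower : Yseq S i ≤ Filling.y T i
  lower with i ∈? S
  ... | yes _  = i₀+col≤y isYT i
  ... | no i∉S = 2*col≤y isYT i i∉S
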